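{- Let $A$ be a countably infinite poset and let $p, q \in \eta(A)$. Then: (1) $(p,q)$ is $<$-valid if and only if $U_p \subseteq U_q$ and $V_p \subseteq U_q \cup V_q$; (2) $(p,q)$ is $\perp$-valid if and only if $U_p \cap W_q = \varnothing$ and $U_q \cap W_p = \varnothing$.
   Context: An external type $p$ over $A$ is the type over $A$ of the new point $e$ of a one-point extension $A \cup \{e\}$; it is identified with the partition $(U_p,V_p,W_p)$ of $A$ where $U_p = \{a : a < e\}$, $V_p = \{a : a \text{ incomparable to } e\}$, $W_p = \{a : a > e\}$. $\eta(A)$ is the set of external types over $A$. For $p, q \in \eta(A)$: $(p,q)$ is $<$-valid if there is a poset $E = A \cup \{b, c\}$ extending $A$ (with $b, c \notin A$ distinct) in which $b$ has type $p$ over $A$, $c$ has type $q$ over $A$, and $b < c$; $(p,q)$ is $\perp$-valid if the same holds with $b < c$ replaced by "$b$ and $c$ are incomparable". -}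

module Defs where

open import Data.Nat using (ℕ)
open import Data.Product using (Σ; _×_)
open import Data.Sum using (_⊎_)
open import Relation.Nullary using (¬_)
open import Relation.Binary.PropositionalEquality using (_≡_)
open import Relation.Binary.Structures using (IsStrictPartialOrder)
open import Function.Bundles using (_⤖_; _⇔_)

record Poset : Set₁ where
  field
    Carrier : Set
    _<_     : Carrier → Carrier → Set
    isSPO   : IsStrictPartialOrder _≡_ _<_

open Poset public

CountablyInfinite : Poset → Set
CountablyInfinite A = ℕ ⤖ Carrier A

-- position of an element a of A relative to a new point e:
-- below (a < e), incomp (a incomparable to e), above (a > e)
data Pos : Set where
  below incomp above : Pos

-- a candidate type over A = a partition (U,V,W) of A, coded as a labelling
Partition : Poset → Set
Partition A = Carrier A → Pos

U V W : (A : Poset) → Partition A → Carrier A → Set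
U A p a = p a ≡ below
V A p a = p a ≡ incomp
W A p a = p a ≡ above

data One (X : Set) : Set where
  old : X → One X
  new : One X

data Two (X : Set) : Set where
  old : X → Two X
  ptb ptc : Two X

Extends : (A : Poset) {Y : Set} → (Carrier A → Y) → (Y → Y → Set) → Set
Extends A ι R =
  IsStrictPartialOrder _≡_ R × (∀ x y → R (ι x) (ι y) ⇔ (_<_ A x y))

HasType : (A : Poset) {Y : Set} → (Carrier A → Y) → (Y → Y → Set) →
          Y → Partition A → Set
HasType A ι R e p =
  ∀ a → ((p a ≡ below) ⇔ R (ι a) e) × ((p a ≡ above) ⇔ R e (ι a))

IsExternalType : (A : Poset) → Partition A → Set₁
IsExternalType A p =
  Σ (One (Carrier A) → One (Carrier A) → Set) λ R →
    Extends A old R × HasType A old R new p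

Incomparable : {Y : Set} → (Y → Y → Set) → Y → Y → Set
Incomparable R x y = ¬ R x y × ¬ R y x

LtValid : (A : Poset) → Partition A → Partition A → Set₁
LtValid A p q =
  Σ (Two (Carrier A) → Two (Carrier A) → Set) λ R →
    Extends A old R × HasType A old R ptb p × HasType A old R ptc q × R ptb ptc

PerpValid : (A : Poset) → Partition A → Partition A → Set₁
PerpValid A p q =
  Σ (Two (Carrier A) → Two (Carrier A) → Set) λ R →
    Extends A old R × HasType A old R ptb p × HasType A old R ptc q ×
    Incomparable R ptb ptc

{-# OPTIONS --safe #-}
module Submission where

-- A point of type p lies above U_p and below W_p, so by transitivity U_p is a
-- down-set, W_p an up-set, and U_p lies entirely below W_p. Conversely, for
-- external types p and q, the relation that places b and c over A according to
-- p and q (with b < c or not, as required) and adds nothing else is already a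
-- strict order, provided the conditions of the theorem hold: they are exactly
-- what transitivity through b < c, and through points of A lying between b and
-- c, demands.

open import Defs
open import Data.Empty using (⊥; ⊥-elim)
open import Data.Product using (_×_; _,_; proj₁; proj₂)
open import Data.Sum using (_⊎_; inj₁; inj₂)
open import Data.Unit using (tt)
open import Function using (id)
open import Function.Bundles using (_⇔_; mk⇔; Equivalence)
open import Relation.Binary.Definitions using (Transitive)
open import Relation.Binary.PropositionalEquality using (_≡_; refl; isEquivalence; resp₂)
open import Relation.Binary.Structures using (IsStrictPartialOrder)
open import Relation.Nullary using (¬_)

open Equivalence using (to; from)

below≢above : ∀ {s : Pos} → s ≡ below → s ≡ above → ⊥
below≢above refl ()

-- Given U_p ⊆ U_q, the condition V_p ⊆ U_q ∪ V_q says pointwise that W_q ⊆ W_p,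
-- which is the form in which transitivity through b < c produces and consumes it.
incomp⇒below⊎incomp : ∀ {s t : Pos} → (t ≡ above → s ≡ above) →
  s ≡ incomp → t ≡ below ⊎ t ≡ incomp
incomp⇒below⊎incomp {t = below}  _ _ = inj₁ refl
incomp⇒below⊎incomp {t = incomp} _ _ = inj₂ refl
incomp⇒below⊎incomp {t = above}  W⊆W refl with W⊆W refl
... | ()

above⇒above : ∀ {s t : Pos} → (s ≡ below → t ≡ below) →
  (s ≡ incomp → t ≡ below ⊎ t ≡ incomp) → t ≡ above → s ≡ above
above⇒above {s = below}  U⊆U _ t≡above = ⊥-elim (below≢above (U⊆U refl) t≡above)
above⇒above {s = incomp} _ V⊆U∪V refl with V⊆U∪V refl
... | inj₁ ()
... | inj₂ ()
above⇒above {s = above}  _ _ _ = refl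

record IsOrderedPartition (A : Poset) (p : Partition A) : Set where
  field
    below-downClosed : ∀ {x y} → _<_ A x y → p y ≡ below → p x ≡ below
    above-upClosed   : ∀ {x y} → p x ≡ above → _<_ A x y → p y ≡ above
    below<above      : ∀ {x y} → p x ≡ below → p y ≡ above → _<_ A x y

hasType⇒isOrderedPartition : ∀ {A Y ι R e p} → Extends A {Y} ι R → HasType A ι R e p →
  IsOrderedPartition A p
hasType⇒isOrderedPartition (spo , ι-embeds) e∶p = record
  { below-downClosed = λ {x} {y} x<y y<e →
      from (proj₁ (e∶p x)) (trans (from (ι-embeds x y) x<y) (to (proj₁ (e∶p y)) y<e))
  ; above-upClosed = λ {x} {y} e<x x<y →
      from (proj₂ (e∶p y)) (trans (to (proj₂ (e∶p x)) e<x) (from (ι-embeds x y) x<y))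
  ; below<above = λ {x} {y} x<e e<y →
      to (ι-embeds x y) (trans (to (proj₁ (e∶p x)) x<e) (to (proj₂ (e∶p y)) e<y))
  }
  where open IsStrictPartialOrder spo using (trans)

externalType⇒isOrderedPartition : ∀ {A p} → IsExternalType A p → IsOrderedPartition A p
externalType⇒isOrderedPartition (_ , ext , new∶p) = hasType⇒isOrderedPartition ext new∶p

module _ (A : Poset) {Y : Set} {ι : Carrier A → Y} {R : Y → Y → Set}
         (ext : Extends A ι R) {b c : Y} {p q : Partition A}
         (b∶p : HasType A ι R b p) (c∶q : HasType A ι R c q) where

  open IsStrictPartialOrder (proj₁ ext) using (trans)

  below-mono : R b c → ∀ a → U A p a → U A q a
  below-mono b<c a a<b = from (proj₁ (c∶q a)) (trans (to (proj₁ (b∶p a)) a<b) b<c)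

  above-antimono : R b c → ∀ a → W A q a → W A p a
  above-antimono b<c a c<a = from (proj₂ (b∶p a)) (trans b<c (to (proj₂ (c∶q a)) c<a))

  below-above-disjoint : ¬ R c b → ∀ a → ¬ (U A p a × W A q a)
  below-above-disjoint c≮b a (a<b , c<a) =
    c≮b (trans (to (proj₂ (c∶q a)) c<a) (to (proj₁ (b∶p a)) a<b))

twoPointOrder : (A : Poset) (p q : Partition A) (b<c : Set) →
  Two (Carrier A) → Two (Carrier A) → Set
twoPointOrder A p q b<c (old x) (old y) = _<_ A x y
twoPointOrder A p q b<c (old x) ptb     = p x ≡ below
twoPointOrder A p q b<c (old x) ptc     = q x ≡ below
twoPointOrder A p q b<c ptb     (old y) = p y ≡ above
twoPointOrder A p q b<c ptc     (old y) = q y ≡ above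
twoPointOrder A p q b<c ptb     ptc     = b<c
twoPointOrder A p q b<c _       _       = ⊥

module _ {A : Poset} {p q : Partition A} {b<c : Set}
         (P : IsOrderedPartition A p) (Q : IsOrderedPartition A q)
         (b<c⇒Up⊆Uq : b<c → ∀ a → U A p a → U A q a)
         (b<c⇒Wq⊆Wp : b<c → ∀ a → W A q a → W A p a)
         (Wp∩Uq⇒b<c : ∀ a → W A p a → U A q a → b<c)
         (¬Up∩Wq    : ∀ a → ¬ (U A p a × W A q a)) where

  private
    _≺_ : Two (Carrier A) → Two (Carrier A) → Set
    _≺_ = twoPointOrder A p q b<c
    module <A = IsStrictPartialOrder (isSPO A)
    module P = IsOrderedPartition P
    module Q = IsOrderedPartition Q

  twoPointOrder-trans : Transitive _≺_
  twoPointOrder-trans {old x} {old y} {old z} x<y y<z = <A.trans x<y y<z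
  twoPointOrder-trans {old x} {old y} {ptb}   x<y y<b = P.below-downClosed x<y y<b
  twoPointOrder-trans {old x} {old y} {ptc}   x<y y<c = Q.below-downClosed x<y y<c
  twoPointOrder-trans {old x} {ptb}   {old z} x<b b<z = P.below<above x<b b<z
  twoPointOrder-trans {old x} {ptb}   {ptc}   x<b b<c = b<c⇒Up⊆Uq b<c x x<b
  twoPointOrder-trans {old x} {ptc}   {old z} x<c c<z = Q.below<above x<c c<z
  twoPointOrder-trans {ptb}   {old y} {old z} b<y y<z = P.above-upClosed b<y y<z
  twoPointOrder-trans {ptb}   {old y} {ptb}   b<y y<b = ⊥-elim (below≢above y<b b<y)
  twoPointOrder-trans {ptb}   {old y} {ptc}   b<y y<c = Wp∩Uq⇒b<c y b<y y<c
  twoPointOrder-trans {ptb}   {ptc}   {old z} b<c c<z = b<c⇒Wq⊆Wp b<c z c<z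
  twoPointOrder-trans {ptc}   {old y} {old z} c<y y<z = Q.above-upClosed c<y y<z
  twoPointOrder-trans {ptc}   {old y} {ptb}   c<y y<b = ⊥-elim (¬Up∩Wq y (y<b , c<y))
  twoPointOrder-trans {ptc}   {old y} {ptc}   c<y y<c = ⊥-elim (below≢above y<c c<y)
  twoPointOrder-trans {old _} {ptb}   {ptb}   _   ()
  twoPointOrder-trans {old _} {ptc}   {ptb}   _   ()
  twoPointOrder-trans {old _} {ptc}   {ptc}   _   ()
  twoPointOrder-trans {ptb}   {ptb}   {_}     ()  _
  twoPointOrder-trans {ptb}   {ptc}   {ptb}   _   ()
  twoPointOrder-trans {ptb}   {ptc}   {ptc}   _   ()
  twoPointOrder-trans {ptc}   {ptb}   {_}     ()  _
  twoPointOrder-trans {ptc}   {ptc}   {_}     ()  _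

  twoPointOrder-irrefl : ∀ {i j} → i ≡ j → ¬ (i ≺ j)
  twoPointOrder-irrefl {old x} refl x<x = <A.irrefl refl x<x
  twoPointOrder-irrefl {ptb}   refl ()
  twoPointOrder-irrefl {ptc}   refl ()

  twoPointOrder-isStrictPartialOrder : IsStrictPartialOrder _≡_ _≺_
  twoPointOrder-isStrictPartialOrder = record
    { isEquivalence = isEquivalence
    ; irrefl        = twoPointOrder-irrefl
    ; trans         = λ {i j k} → twoPointOrder-trans {i} {j} {k}
    ; <-resp-≈      = resp₂ _≺_
    }

  twoPointOrder-realises : Extends A old _≺_ × HasType A old _≺_ ptb p × HasType A old _≺_ ptc q
  twoPointOrder-realises =
    (twoPointOrder-isStrictPartialOrder , λ _ _ → mk⇔ id id) ,
    (λ _ → mk⇔ id id , mk⇔ id id) ,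
    (λ _ → mk⇔ id id , mk⇔ id id)

LtCondition : (A : Poset) → Partition A → Partition A → Set
LtCondition A p q = (∀ a → U A p a → U A q a) × (∀ a → V A p a → U A q a ⊎ V A q a)

PerpCondition : (A : Poset) → Partition A → Partition A → Set
PerpCondition A p q = (∀ a → ¬ (U A p a × W A q a)) × (∀ a → ¬ (U A q a × W A p a))

module _ (A : Poset) {p q : Partition A}
         (p-external : IsExternalType A p) (q-external : IsExternalType A q) where

  private
    P : IsOrderedPartition A p
    P = externalType⇒isOrderedPartition p-external
    Q : IsOrderedPartition A q
    Q = externalType⇒isOrderedPartition q-external

  ltValid⇔ : LtValid A p q ⇔ LtCondition A p q
  ltValid⇔ = mk⇔ necessary sufficient
    where
    necessary : LtValid A p q → LtCondition A p q
    necessary (_ , ext , b∶p , c∶q , b<c) =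
      below-mono A ext b∶p c∶q b<c ,
      λ a → incomp⇒below⊎incomp (above-antimono A ext b∶p c∶q b<c a)
    sufficient : LtCondition A p q → LtValid A p q
    sufficient (Up⊆Uq , Vp⊆Uq∪Vq) =
      let ext , b∶p , c∶q = twoPointOrder-realises P Q (λ _ → Up⊆Uq) (λ _ → Wq⊆Wp)
                              (λ _ _ _ → tt) (λ a (u , w) → below≢above (Up⊆Uq a u) w)
      in _ , ext , b∶p , c∶q , tt
      where
      Wq⊆Wp : ∀ a → W A q a → W A p a
      Wq⊆Wp a = above⇒above (Up⊆Uq a) (Vp⊆Uq∪Vq a)

  perpValid⇔ : PerpValid A p q ⇔ PerpCondition A p q
  perpValid⇔ = mk⇔ necessary sufficient
    where
    necessary : PerpValid A p q → PerpCondition A p q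
    necessary (_ , ext , b∶p , c∶q , b≮c , c≮b) =
      below-above-disjoint A ext b∶p c∶q c≮b , below-above-disjoint A ext c∶q b∶p b≮c
    sufficient : PerpCondition A p q → PerpValid A p q
    sufficient (¬Up∩Wq , ¬Uq∩Wp) =
      let ext , b∶p , c∶q = twoPointOrder-realises P Q (λ ()) (λ ())
                              (λ a w u → ¬Uq∩Wp a (u , w)) ¬Up∩Wq
      in _ , ext , b∶p , c∶q , (λ ()) , (λ ())

lemma2p10 : (A : Poset) → CountablyInfinite A →
    (p q : Partition A) → IsExternalType A p → IsExternalType A q →
    (LtValid A p q ⇔ ((∀ a → U A p a → U A q a) × (∀ a → V A p a → U A q a ⊎ V A q a)))
    × (PerpValid A p q ⇔ ((∀ a → ¬ (U A p a × W A q a)) × (∀ a → ¬ (U A q a × W A p a))))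
lemma2p10 A _ p q p-external q-external =
  ltValid⇔ A p-external q-external , perpValid⇔ A p-external q-external
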